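{- Let $N$ be a labeled Petri net and $C$ a set of markings of $N$. Then $(N,C)$ is a coherent net if and only if for every label $a\in\Sigma$ and all markings $m,m'$ with $m\in C$ and $m\overset{a}{\twoheadrightarrow}m'$, there exists $m''\in C$ such that $m\overset{a}{\twoheadrightarrow}m''$ and $m''\xRightarrow{\epsilon}m'$.
   Context: A labeled Petri net $N=(P,T,\mathrm{Pre},\mathrm{Post})$ has finite place set $P$, finite transition set $T$ (disjoint from $P$), $\mathrm{Pre},\mathrm{Post}:T\to(P\to\mathbb N)$, and labeling $l:T\to\Sigma\cup\{\tau\}$ with $\tau\notin\Sigma$ the silent action. A marking is $m:P\to\mathbb N$. Transition $t$ is enabled at $m$ if $m(p)\ge\mathrm{Pre}(t,p)$ for all $p$, and then $m\xrightarrow{t}m'$ with $m'=m-\mathrm{Pre}(t)+\mathrm{Post}(t)$; $m\xRightarrow{\varrho}m'$ for $\varrho\in T^*$ denotes firing along $\varrho$. Extend $l$ to $T^*$ by $l(\epsilon)=\epsilon$, $l(\varrho t)=l(\varrho)$ if $l(t)=\tau$, $l(\varrho t)=l(\varrho)l(t)$ otherwise. For $\sigma\in\Sigma^*$, $m\xRightarrow{\sigma}m'$ means there is $\varrho$ with $m\xRightarrow{\varrho}m'$ and $l(\varrho)=\sigma$. Define $m\overset{\epsilon}{\twoheadrightarrow}m'$ iff $m'=m$, and for $\sigma\in\Sigma^*$, $a\in\Sigma$: $m\overset{\sigma a}{\twoheadrightarrow}m'$ iff there exist $m''$ and $t$ with $l(t)=a$ and $m\xRightarrow{\sigma}m''\xrightarrow{t}m'$.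 $(N,C)$ is a coherent net if for every $m\in C$, every $\sigma\in\Sigma^*$ and every $m'$ with $m\xRightarrow{\sigma}m'$, there exists $m''\in C$ with $m\overset{\sigma}{\twoheadrightarrow}m''$ and $m''\xRightarrow{\epsilon}m'$. -}

module Defs where

open import Data.Nat using (ℕ; _+_; _∸_; _≤_)
open import Data.Fin using (Fin)
open import Data.Vec using (Vec; lookup; zipWith)
open import Data.Maybe using (Maybe; just; nothing)
open import Data.List using (List; []; _∷_; _∷ʳ_)
open import Data.Product using (Σ; ∃; _×_; _,_)
open import Relation.Binary.PropositionalEquality using (_≡_)
open import Level using (Level; _⊔_; suc)

-- A labeled Petri net over label alphabet Σ with finitely many places
-- (Fin np) and transitions (Fin nt).  Labels are Maybe Σ, nothing = τ.
record LPN {ℓ : Level} (Lab : Set ℓ) : Set ℓ where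
  field
    np  : ℕ
    nt  : ℕ
    Pre  : Fin nt → Vec ℕ np
    Post : Fin nt → Vec ℕ np
    lab  : Fin nt → Maybe Lab

module _ {ℓ : Level} {Lab : Set ℓ} (N : LPN Lab) where
  open LPN N

  Marking : Set
  Marking = Vec ℕ np

  Enabled : Fin nt → Marking → Set
  Enabled t m = ∀ (p : Fin np) → lookup (Pre t) p ≤ lookup m p

  Fires : Marking → Fin nt → Marking → Set
  Fires m t m' = Enabled t m × (m' ≡ zipWith _+_ (zipWith _∸_ m (Pre t)) (Post t))

  data FiresSeq : Marking → List (Fin nt) → Marking → Set where
    fs-nil  : ∀ {m} → FiresSeq m [] m
    fs-snoc : ∀ {m ϱ ϱt m₁ t m'} → ϱt ≡ ϱ ∷ʳ t → FiresSeq m ϱ m₁ → Fires m₁ t m'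
            → FiresSeq m ϱt m'

  labSeq : List (Fin nt) → List Lab
  labSeq [] = []
  labSeq (t ∷ ϱ) with lab t
  ... | nothing = labSeq ϱ
  ... | just a  = a ∷ labSeq ϱ

  Obs : Marking → List Lab → Marking → Set ℓ
  Obs m σ m' = Σ (List (Fin nt)) λ ϱ → FiresSeq m ϱ m' × labSeq ϱ ≡ σ

  -- m --σ->> m' : ends with a visible transition (or σ = ε and m' = m)
  data ObsEnd : Marking → List Lab → Marking → Set ℓ where
    oe-nil  : ∀ {m} → ObsEnd m [] m
    oe-snoc : ∀ {m σ a σa m'' t m'} → σa ≡ σ ∷ʳ a → Obs m σ m'' → Fires m'' t m'
            → lab t ≡ just a → ObsEnd m σa m'

  Coherent : ∀ {c} → (Marking → Set c) → Set (ℓ ⊔ c)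
  Coherent C = ∀ (m : Marking) → C m → ∀ (σ : List Lab) (m' : Marking) → Obs m σ m'
             → Σ Marking λ m'' → C m'' × ObsEnd m σ m'' × Obs m'' [] m'

-- Such a reconciliation is built along the run, one transition at a
-- time: a silent transition only lengthens the silent tail, while a visible
-- transition a, fired after the silent tail from the current state of C, is
-- exactly an instance of the one-label condition, whose answer is appended to
-- the run reconciled so far.
module Submission where

open import Defs
open import Level using (Level; _⊔_)
open import Data.List using (List; []; _∷_; _++_; _∷ʳ_)
open import Data.List.Properties using (++-assoc; ++-identityʳ)
open import Data.Fin using (Fin)
open import Data.Maybe using (just; nothing)
open import Data.Product using (Σ; _×_; _,_)
open import Function.Bundles using (_⇔_; mk⇔)
open import Relation.Binary.PropositionalEquality using (_≡_; refl; sym; trans; cong; cong₂; subst)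

module _ {ℓ : Level} {Lab : Set ℓ} (N : LPN Lab) where
  open LPN N

  labSeq-++ : ∀ ϱ ϱ′ → labSeq N (ϱ ++ ϱ′) ≡ labSeq N ϱ ++ labSeq N ϱ′
  labSeq-++ [] ϱ′ = refl
  labSeq-++ (t ∷ ϱ) ϱ′ with lab t
  ... | nothing = labSeq-++ ϱ ϱ′
  ... | just a  = cong (a ∷_) (labSeq-++ ϱ ϱ′)

  labSeq-∷ʳ-silent : ∀ ϱ {t} → lab t ≡ nothing → labSeq N (ϱ ∷ʳ t) ≡ labSeq N ϱ
  labSeq-∷ʳ-silent ϱ {t} lab-t with lab t | labSeq-++ ϱ (t ∷ [])
  labSeq-∷ʳ-silent ϱ refl | nothing | eq = trans eq (++-identityʳ (labSeq N ϱ))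

  labSeq-∷ʳ-visible : ∀ ϱ {t a} → lab t ≡ just a → labSeq N (ϱ ∷ʳ t) ≡ labSeq N ϱ ∷ʳ a
  labSeq-∷ʳ-visible ϱ {t} lab-t with lab t | labSeq-++ ϱ (t ∷ [])
  labSeq-∷ʳ-visible ϱ refl | just a | eq = eq

  FiresSeq-++ : ∀ {m ϱ m₁ ϱ′ m₂} → FiresSeq N m ϱ m₁ → FiresSeq N m₁ ϱ′ m₂
              → FiresSeq N m (ϱ ++ ϱ′) m₂
  FiresSeq-++ {ϱ = ϱ} run fs-nil = subst (λ ϱ″ → FiresSeq N _ ϱ″ _) (sym (++-identityʳ ϱ)) run
  FiresSeq-++ {ϱ = ϱ} run (fs-snoc {ϱ = ϱ′} {t = t} refl run′ step) =
    fs-snoc (sym (++-assoc ϱ ϱ′ (t ∷ []))) (FiresSeq-++ run run′) step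

  Obs-++-silent : ∀ {m σ m₁ m₂} → Obs N m σ m₁ → Obs N m₁ [] m₂ → Obs N m σ m₂
  Obs-++-silent {σ = σ} (ϱ , run , lab-ϱ) (ϱ′ , run′ , lab-ϱ′) =
    ϱ ++ ϱ′ , FiresSeq-++ run run′ ,
    trans (labSeq-++ ϱ ϱ′) (trans (cong₂ _++_ lab-ϱ lab-ϱ′) (++-identityʳ σ))

  Obs-∷ʳ-silent : ∀ {m σ m₁ t m₂} → Obs N m σ m₁ → Fires N m₁ t m₂ → lab t ≡ nothing
                → Obs N m σ m₂
  Obs-∷ʳ-silent (ϱ , run , lab-ϱ) step lab-t =
    _ , fs-snoc refl run step , trans (labSeq-∷ʳ-silent ϱ lab-t) lab-ϱ

  Obs-∷ʳ-visible : ∀ {m σ m₁ t m₂ a} → Obs N m σ m₁ → Fires N m₁ t m₂ → lab t ≡ just a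
                 → Obs N m (σ ∷ʳ a) m₂
  Obs-∷ʳ-visible (ϱ , run , lab-ϱ) step lab-t =
    _ , fs-snoc refl run step , trans (labSeq-∷ʳ-visible ϱ lab-t) (cong (_∷ʳ _) lab-ϱ)

  ObsEnd⇒Obs : ∀ {m σ m′} → ObsEnd N m σ m′ → Obs N m σ m′
  ObsEnd⇒Obs oe-nil                       = [] , fs-nil , refl
  ObsEnd⇒Obs (oe-snoc refl run step lab-t) = Obs-∷ʳ-visible run step lab-t

  ObsEnd-∷ʳ : ∀ {m σ m₁ m₂ t m₃ a} → ObsEnd N m σ m₁ → Obs N m₁ [] m₂ → Fires N m₂ t m₃
            → lab t ≡ just a → ObsEnd N m (σ ∷ʳ a) m₃
  ObsEnd-∷ʳ run tail step lab-t = oe-snoc refl (Obs-++-silent (ObsEnd⇒Obs run) tail) step lab-t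

  record SilentThenVisible (m : Marking N) (a : Lab) (m′ : Marking N) : Set ℓ where
    field
      {before}  : Marking N
      {visible} : Fin nt
      silent    : Obs N m [] before
      fires     : Fires N before visible m′
      labelled  : lab visible ≡ just a

  ObsEnd-[a]-inversion : ∀ {m a m′} → ObsEnd N m (a ∷ []) m′ → SilentThenVisible m a m′
  ObsEnd-[a]-inversion (oe-snoc {σ = []} refl run step lab-t) = record
    { silent = run ; fires = step ; labelled = lab-t }
  ObsEnd-[a]-inversion (oe-snoc {σ = _ ∷ []} () _ _ _)
  ObsEnd-[a]-inversion (oe-snoc {σ = _ ∷ _ ∷ _} () _ _ _)

  module _ {c : Level} (C : Marking N → Set c) where

    Reconciled : Marking N → List Lab → Marking N → Set (ℓ ⊔ c)
    Reconciled m σ m′ = Σ (Marking N) λ m″ → C m″ × ObsEnd N m σ m″ × Obs N m″ [] m′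

    LabelCoherent : Set (ℓ ⊔ c)
    LabelCoherent = ∀ (a : Lab) (m m′ : Marking N) → C m → ObsEnd N m (a ∷ []) m′
                  → Reconciled m (a ∷ []) m′

    Reconciled-∷ʳ-silent : ∀ {m σ m₁ t m₂} → Reconciled m σ m₁ → Fires N m₁ t m₂
                         → lab t ≡ nothing → Reconciled m σ m₂
    Reconciled-∷ʳ-silent (m″ , Cm″ , run , tail) step lab-t =
      m″ , Cm″ , run , Obs-∷ʳ-silent tail step lab-t

    Reconciled-∷ʳ-visible : LabelCoherent → ∀ {m σ m₁ t m₂ a} → Reconciled m σ m₁
                          → Fires N m₁ t m₂ → lab t ≡ just a → Reconciled m (σ ∷ʳ a) m₂
    Reconciled-∷ʳ-visible coh (m″ , Cm″ , run , tail) step lab-t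
      with coh _ m″ _ Cm″ (oe-snoc refl tail step lab-t)
    ... | m‴ , Cm‴ , run′ , tail′ =
      let open SilentThenVisible (ObsEnd-[a]-inversion run′)
      in m‴ , Cm‴ , ObsEnd-∷ʳ run silent fires labelled , tail′

    FiresSeq-reconciled : LabelCoherent → ∀ {m ϱ m′} → C m → FiresSeq N m ϱ m′
                        → Reconciled m (labSeq N ϱ) m′
    FiresSeq-reconciled coh {m} Cm fs-nil = m , Cm , oe-nil , [] , fs-nil , refl
    FiresSeq-reconciled coh Cm (fs-snoc {ϱ = ϱ} {t = t} refl run step)
      with lab t in lab-t
    ... | nothing = subst (λ σ → Reconciled _ σ _) (sym (labSeq-∷ʳ-silent ϱ lab-t))
                      (Reconciled-∷ʳ-silent (FiresSeq-reconciled coh Cm run) step lab-t)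
    ... | just a  = subst (λ σ → Reconciled _ σ _) (sym (labSeq-∷ʳ-visible ϱ lab-t))
                      (Reconciled-∷ʳ-visible coh (FiresSeq-reconciled coh Cm run) step lab-t)

lemma3 : ∀ {ℓ c : Level} {Lab : Set ℓ} (N : LPN Lab) (C : Marking N → Set c)
       → Coherent N C
         ⇔ (∀ (a : Lab) (m m' : Marking N) → C m → ObsEnd N m (a ∷ []) m'
            → Σ (Marking N) λ m'' → C m'' × ObsEnd N m (a ∷ []) m'' × Obs N m'' [] m')
lemma3 N C = mk⇔
  (λ coh a m m′ Cm run → coh m Cm (a ∷ []) m′ (ObsEnd⇒Obs N run))
  (λ coh m Cm σ m′ (ϱ , run , lab-ϱ) →
     subst (λ σ → Reconciled N C m σ m′) lab-ϱ (FiresSeq-reconciled N C coh Cm run))
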